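{- Let $G$ be an interval graph with $\nu(G)=k$, and let $(\alpha,\beta,\gamma)=(\nu(G_\alpha)-1,\nu(G_\beta)-1,\nu(G_\gamma)-1)$ be its triple. Then $(\alpha,\beta,\gamma)$ is one of $(k,k-1,k-1)$, $(k,k-1,k)$, $(k,k,k)$.
   Context: An interval representation $\mathcal{R}$ of a graph assigns to each vertex $x$ a closed interval $\langle x\rangle$ of the real line such that two vertices are adjacent iff their intervals intersect. For a vertex $x$, $\nu(x)$ is the largest $k$ such that there are vertices $x_1,\dots,x_k=x$ with $\langle x_1\rangle\subsetneq\cdots\subsetneq\langle x_k\rangle$; $\nu(\mathcal{R})=\max_x\nu(x)$ ($0$ for the empty graph), and $\nu(H)$ is the minimum of $\nu(\mathcal{R})$ over all interval representations $\mathcal{R}$ of $H$. Given an interval graph $G$: $G_\alpha$ is obtained from $G$ by adding a vertex $u_\alpha$ adjacent to every vertex of $G$, together with two attached paths $a_1a_2$ and $b_1b_2$ on new vertices, where $a_1,b_1$ are adjacent to $u_\alpha$ and to no vertex of $G$, and $a_2,b_2$ are adjacent only to $a_1$, $b_1$ respectively. $G_\beta$ is obtained from $G$ by adding a vertex $u_\beta$ adjacent to every vertex of $G$ together with one such attached path at $u_\beta$. $G_\gamma$ is obtained from $G$ by adding two adjacent vertices $u_\gamma,v_\gamma$, each adjacent to every vertex of $G$, each with its own such attached path (adjacent to no other added vertex and no vertex of $G$).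
   Formalization: Interval representations use closed intervals with rational endpoints rather than closed intervals of the real line, so ν(G), ν(G_α), ν(G_β), ν(G_γ) and being an interval graph refer to rational representations. -}

module Defs where

open import Data.Nat using (ℕ; zero; suc; _+_; _≤_; _≡ᵇ_)
open import Data.Fin using (Fin; toℕ; splitAt)
open import Data.Bool using (Bool; true; false; _∨_)
open import Data.Sum using (_⊎_; inj₁; inj₂)
open import Data.Product using (Σ; ∃; _×_; _,_)
open import Data.Rational using (ℚ) renaming (_≤_ to _≤ℚ_)
open import Relation.Binary.PropositionalEquality using (_≡_; _≢_)
open import Relation.Nullary using (¬_)
open import Function.Bundles using (_⇔_)

-- Only pairs of distinct vertices matter (loops are ignored by every
-- notion below); symmetry is forced by the existence of a representation.

record Graph : Set where
  constructor mkGraph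
  field
    size : ℕ
    Adj  : Fin size → Fin size → Bool
open Graph public

record Interval : Set where
  constructor ⟦_,_⟧⟨_⟩
  field
    lo hi : ℚ
    lo≤hi : lo ≤ℚ hi
open Interval public

_∋_ : Interval → ℚ → Set
I ∋ q = (lo I ≤ℚ q) × (q ≤ℚ hi I)

Intersect : Interval → Interval → Set
Intersect I J = ∃ λ q → (I ∋ q) × (J ∋ q)

_⊆I_ : Interval → Interval → Set
I ⊆I J = ∀ q → I ∋ q → J ∋ q

_⊊I_ : Interval → Interval → Set
I ⊊I J = (I ⊆I J) × (∃ λ q → (J ∋ q) × ¬ (I ∋ q))

Rep : ℕ → Set
Rep n = Fin n → Interval

IsIntervalRep : (G : Graph) → Rep (size G) → Set
IsIntervalRep G R =
  ∀ x y → x ≢ y → (Adj G x y ≡ true) ⇔ Intersect (R x) (R y)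

IsIntervalGraph : Graph → Set
IsIntervalGraph G = ∃ λ R → IsIntervalRep G R

data Chain {n : ℕ} (R : Rep n) : Fin n → ℕ → Set where
  single : ∀ x → Chain R x 1
  step   : ∀ {y x k} → Chain R y k → R y ⊊I R x → Chain R x (suc k)

NuVertex : {n : ℕ} → Rep n → Fin n → ℕ → Set
NuVertex R x k = Chain R x k × (∀ j → Chain R x j → j ≤ k)

NuRep : {n : ℕ} → Rep n → ℕ → Set
NuRep {n} R m =
  ((n ≡ 0) × (m ≡ 0))
  ⊎ ((∃ λ x → NuVertex R x m) × (∀ x k → NuVertex R x k → k ≤ m))

NuGraph : Graph → ℕ → Set
NuGraph H m =
  (∃ λ R → IsIntervalRep H R × NuRep R m)
  × (∀ R m′ → IsIntervalRep H R → NuRep R m′ → m ≤ m′)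

-- Gadgets.  A gadget is the path on vertices 0 - 1 - ⋯ - (m-1)
-- together with a set U of "universal" gadget vertices, which are made
-- adjacent to every vertex of G.

pathAdj : {m : ℕ} → Fin m → Fin m → Bool
pathAdj i j = ((suc (toℕ i)) ≡ᵇ toℕ j) ∨ ((suc (toℕ j)) ≡ᵇ toℕ i)

attach : (m : ℕ) → (Fin m → Bool) → Graph → Graph
attach m U G = mkGraph (m + size G) adj
  where
  adj : Fin (m + size G) → Fin (m + size G) → Bool
  adj x y with splitAt m x | splitAt m y
  ... | inj₁ g | inj₁ h = pathAdj g h
  ... | inj₁ g | inj₂ _ = U g
  ... | inj₂ _ | inj₁ h = U h
  ... | inj₂ i | inj₂ j = Adj G i j

-- G_α : path a₂ - a₁ - u_α - b₁ - b₂  (indices 0..4), u_α = 2 universal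
Uα : Fin 5 → Bool
Uα i = toℕ i ≡ᵇ 2

Gα : Graph → Graph
Gα = attach 5 Uα

-- G_β : path a₂ - a₁ - u_β  (indices 0..2), u_β = 2 universal
Uβ : Fin 3 → Bool
Uβ i = toℕ i ≡ᵇ 2

Gβ : Graph → Graph
Gβ = attach 3 Uβ

-- G_γ : path a₂ - a₁ - u_γ - v_γ - b₁ - b₂ (indices 0..5),
-- u_γ = 2 and v_γ = 3 universal (and adjacent to each other)
Uγ : Fin 6 → Bool
Uγ i = (toℕ i ≡ᵇ 2) ∨ (toℕ i ≡ᵇ 3)

Gγ : Graph → Graph
Gγ = attach 6 Uγ

module Submission where

-- Let k = ν(G) and a, b, c be ν of G_α, G_β, G_γ (so (α,β,γ) = (a-1, b-1, c-1)).
-- The theorem follows from four inequalities: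
--   (1) a ≥ k+1: in every representation of G_α the interval of u_α strictly contains
--       every interval of G, because the pendant paths a₁a₂ and b₁b₂ pin down both
--       ends of ⟨u_α⟩ outside the intervals of G;
--   (2) ν is monotone along induced subgraphs, and G ⊆ G_β ⊆ G_γ, so k ≤ b ≤ c;
--   (3) a ≤ k+1 and c ≤ k+1: take an optimal representation of G, spanning [L, H],
--       and place the gadget intervals around it (universal vertices covering
--       [L, H], path vertices outside it, no gadget interval inside another); every
--       chain then has at most one gadget interval, on top.
-- Given a = k+1 and k ≤ b ≤ c ≤ k+1, the three listed triples are the only options.

open import Defs
open import Data.Nat using (ℕ; suc)
open import Data.Sum using (_⊎_)
open import Data.Product using (_×_)
open import Relation.Binary.PropositionalEquality using (_≡_)

open import Data.Nat using (zero; _+_; _≤_; _≤?_; z≤n; s≤s)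
open import Data.Nat.Properties
  using (≤-trans; ≤-antisym; ≤-pred; ≰⇒>; m≤n⇒m<n∨m≡n; m≤n⇒m≤1+n; n≤0⇒n≡0)
open import Data.Fin as Fin using (Fin; splitAt; join; _↑ˡ_; _↑ʳ_)
open import Data.Fin.Properties
  using (splitAt-join; join-splitAt; splitAt-↑ʳ; ↑ˡ-injective; ↑ʳ-injective; toℕ-↑ˡ; pigeonhole; any?; all?; _≟_)
open import Data.Vec using (_∷_; []; lookup)
open import Data.Bool using (Bool; true; false; T; if_then_else_; _∧_; _∨_)
open import Data.Bool.Properties using (T?; T-∧; T-∨)
open import Data.Sum using (inj₁; inj₂; [_,_]) renaming (map₁ to relabel)
open import Data.Sum.Properties using (inj₁-injective)
open import Data.Product using (∃; ∃₂; _,_; proj₁; proj₂)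
open import Data.Empty using (⊥-elim)
open import Data.Integer using (+_)
open import Data.Rational as Q using (ℚ; 0ℚ)
import Data.Rational.Properties as QP
open import Relation.Binary.PropositionalEquality
  using (refl; sym; trans; cong; cong₂; subst; subst₂; _≢_; module ≡-Reasoning)
open import Relation.Nullary using (¬_; Dec; yes; no; ¬?; _×-dec_; _→-dec_)
open import Relation.Nullary.Decidable using (True; isYes; toWitness)
open import Function using (_∘_)
open import Function.Bundles using (_⇔_; mk⇔; Equivalence)

open Equivalence using (to; from)

<⇒≱ : ∀ {p q} → p Q.< q → ¬ (q Q.≤ p)
<⇒≱ p<q q≤p = QP.<-irrefl refl (QP.<-≤-trans p<q q≤p)

-- Geometry of closed intervals

meet⇒ : ∀ {I J} → Intersect I J → (lo I Q.≤ hi J) × (lo J Q.≤ hi I)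
meet⇒ (_ , (lI≤q , q≤hI) , (lJ≤q , q≤hJ)) = QP.≤-trans lI≤q q≤hJ , QP.≤-trans lJ≤q q≤hI

meet⇐ : ∀ {I J} → lo I Q.≤ hi J → lo J Q.≤ hi I → Intersect I J
meet⇐ {I} {J} lI≤hJ lJ≤hI =
  lo I Q.⊔ lo J
  , (QP.p≤p⊔q (lo I) (lo J) , QP.⊔-lub (lo≤hi I) lJ≤hI)
  , (QP.p≤q⊔p (lo I) (lo J) , QP.⊔-lub lI≤hJ (lo≤hi J))

meet-sym : ∀ {I J} → Intersect I J → Intersect J I
meet-sym (q , q∈I , q∈J) = q , q∈J , q∈I

before⇒disjoint : ∀ {I J} → hi I Q.< lo J → ¬ Intersect I J
before⇒disjoint {I} {J} hI<lJ I∩J = <⇒≱ hI<lJ (proj₂ (meet⇒ {I} {J} I∩J))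

after⇒disjoint : ∀ {I J} → hi J Q.< lo I → ¬ Intersect I J
after⇒disjoint {I} {J} hJ<lI I∩J = <⇒≱ hJ<lI (proj₁ (meet⇒ {I} {J} I∩J))

disjoint⇒ : ∀ {I J} → ¬ Intersect I J → (hi I Q.< lo J) ⊎ (hi J Q.< lo I)
disjoint⇒ {I} {J} I∦J with lo I Q.≤? hi J | lo J Q.≤? hi I
... | yes lI≤hJ | yes lJ≤hI = ⊥-elim (I∦J (meet⇐ {I} {J} lI≤hJ lJ≤hI))
... | _         | no lJ≰hI  = inj₁ (QP.≰⇒> lJ≰hI)
... | no lI≰hJ  | yes _     = inj₂ (QP.≰⇒> lI≰hJ)

⊆⇒ : ∀ {I J} → I ⊆I J → (lo J Q.≤ lo I) × (hi I Q.≤ hi J)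
⊆⇒ {I} I⊆J = proj₁ (I⊆J (lo I) (QP.≤-refl , lo≤hi I)) , proj₂ (I⊆J (hi I) (lo≤hi I , QP.≤-refl))

⊆⇐ : ∀ {I J} → lo J Q.≤ lo I → hi I Q.≤ hi J → I ⊆I J
⊆⇐ lJ≤lI hI≤hJ _ (lI≤q , q≤hI) = QP.≤-trans lJ≤lI lI≤q , QP.≤-trans q≤hI hI≤hJ

¬⊆-lo : ∀ {I J} → lo I Q.< lo J → ¬ (I ⊆I J)
¬⊆-lo {I} {J} lI<lJ I⊆J = <⇒≱ lI<lJ (proj₁ (⊆⇒ {I} {J} I⊆J))

¬⊆-hi : ∀ {I J} → hi J Q.< hi I → ¬ (I ⊆I J)
¬⊆-hi {I} {J} hJ<hI I⊆J = <⇒≱ hJ<hI (proj₂ (⊆⇒ {I} {J} I⊆J))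

⊊⇐ : ∀ {I J} → lo J Q.≤ lo I → hi I Q.≤ hi J → (lo J Q.< lo I) ⊎ (hi I Q.< hi J) → I ⊊I J
⊊⇐ {I} {J} lJ≤lI hI≤hJ (inj₁ lJ<lI) =
  ⊆⇐ {I} {J} lJ≤lI hI≤hJ , lo J , (QP.≤-refl , lo≤hi J) , λ (lI≤lJ , _) → <⇒≱ lJ<lI lI≤lJ
⊊⇐ {I} {J} lJ≤lI hI≤hJ (inj₂ hI<hJ) =
  ⊆⇐ {I} {J} lJ≤lI hI≤hJ , hi J , (lo≤hi J , QP.≤-refl) , λ (_ , hJ≤hI) → <⇒≱ hI<hJ hJ≤hI

⊊⇒ : ∀ {I J} → I ⊊I J → (lo J Q.< lo I) ⊎ (hi I Q.< hi J)
⊊⇒ {I} {J} (I⊆J , q , (lJ≤q , q≤hJ) , q∉I) with lo J Q.<? lo I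
... | yes lJ<lI = inj₁ lJ<lI
... | no lJ≮lI  = inj₂ (QP.<-≤-trans (QP.≰⇒> λ q≤hI → q∉I (QP.≤-trans (QP.≮⇒≥ lJ≮lI) lJ≤q , q≤hI)) q≤hJ)

⊊? : ∀ I J → Dec (I ⊊I J)
⊊? I J with lo J Q.≤? lo I | hi I Q.≤? hi J | lo J Q.<? lo I | hi I Q.<? hi J
... | no lJ≰lI  | _         | _         | _         = no (lJ≰lI ∘ proj₁ ∘ ⊆⇒ {I} {J} ∘ proj₁)
... | yes _     | no hI≰hJ  | _         | _         = no (hI≰hJ ∘ proj₂ ∘ ⊆⇒ {I} {J} ∘ proj₁)
... | yes lJ≤lI | yes hI≤hJ | yes lJ<lI | _         = yes (⊊⇐ {I} {J} lJ≤lI hI≤hJ (inj₁ lJ<lI))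
... | yes lJ≤lI | yes hI≤hJ | no _      | yes hI<hJ = yes (⊊⇐ {I} {J} lJ≤lI hI≤hJ (inj₂ hI<hJ))
... | yes _     | yes _     | no lJ≮lI  | no hI≮hJ  = no ([ lJ≮lI , hI≮hJ ] ∘ ⊊⇒ {I} {J})

-- Strict containment is a strict order; this is what makes chains finite.
⊊-irrefl : ∀ {I} → ¬ (I ⊊I I)
⊊-irrefl (_ , _ , q∈I , q∉I) = q∉I q∈I

⊊-trans : ∀ {I J K} → I ⊊I J → J ⊊I K → I ⊊I K
⊊-trans (I⊆J , _) (J⊆K , q , q∈K , q∉J) = (λ p → J⊆K p ∘ I⊆J p) , q , q∈K , q∉J ∘ I⊆J q

-- ν(x) and ν(R) exist for every representation R

module _ {n : ℕ} (R : Rep n) where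

  chain? : ∀ x j → Dec (Chain R x j)
  chain? x zero = no λ ()
  chain? x (suc zero) = yes (single x)
  chain? x (suc (suc j)) with any? (λ y → chain? y (suc j) ×-dec ⊊? (R y) (R x))
  ... | yes (y , c , y⊊x) = yes (step c y⊊x)
  ... | no ∄y = no λ { (step c y⊊x) → ∄y (_ , c , y⊊x) }

  -- The i-th vertex of a chain, counted from its top x downwards.
  chainVertex : ∀ {x j} → Chain R x j → Fin j → Fin n
  chainVertex (single x) _ = x
  chainVertex {x} (step c _) Fin.zero = x
  chainVertex (step c _) (Fin.suc i) = chainVertex c i

  inside-step : ∀ {x y j} (c : Chain R y j) → R y ⊊I R x → ∀ i → R (chainVertex c i) ⊊I R x
  inside-step (single _) y⊊x _ = y⊊x
  inside-step (step _ _) y⊊x Fin.zero = y⊊x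
  inside-step {x} (step {z} c z⊊y) y⊊x (Fin.suc i) = inside-step c (⊊-trans {R z} {R _} {R x} z⊊y y⊊x) i

  chainVertex-nested : ∀ {x j} (c : Chain R x j) {i i′} → i Fin.< i′ →
    R (chainVertex c i′) ⊊I R (chainVertex c i)
  chainVertex-nested (step c y⊊x) {Fin.zero} {Fin.suc i′} _ = inside-step c y⊊x i′
  chainVertex-nested (step c _) {Fin.suc i} {Fin.suc i′} (s≤s i<i′) = chainVertex-nested c i<i′

  -- Hence a chain visits distinct vertices and is no longer than n (pigeonhole).
  chain-length≤ : ∀ {x j} → Chain R x j → j ≤ n
  chain-length≤ {j = j} c with j ≤? n
  ... | yes j≤n = j≤n
  ... | no j≰n with pigeonhole (≰⇒> j≰n) (chainVertex c)
  ...   | i , i′ , i<i′ , same =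
    ⊥-elim (⊊-irrefl {R (chainVertex c i)}
                     (subst (λ v → R v ⊊I R (chainVertex c i)) (sym same) (chainVertex-nested c i<i′)))

largest : {P : ℕ → Set} → (∀ j → Dec (P j)) → ∀ N {j} → P j → j ≤ N →
  ∃ λ m → P m × (∀ i → P i → i ≤ N → i ≤ m)
largest {P} P? zero pj j≤0 = 0 , subst P (n≤0⇒n≡0 j≤0) pj , λ _ _ i≤0 → i≤0
largest {P} P? (suc N) pj j≤N+1 with P? (suc N)
... | yes pN+1 = suc N , pN+1 , λ _ _ i≤N+1 → i≤N+1
... | no ¬pN+1 =
  let m , pm , maximal = largest P? N pj (below-top pj j≤N+1)
  in m , pm , λ i pi i≤N+1 → maximal i pi (below-top pi i≤N+1)
  where
  below-top : ∀ {i} → P i → i ≤ suc N → i ≤ N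
  below-top {i} pi i≤N+1 with m≤n⇒m<n∨m≡n i≤N+1
  ... | inj₁ i<N+1 = ≤-pred i<N+1
  ... | inj₂ refl = ⊥-elim (¬pN+1 pi)

-- ν(x) exists: chain lengths at x are bounded by n and attained at 1.
νVertex-exists : ∀ {n} (R : Rep n) x → ∃ (NuVertex R x)
νVertex-exists {n} R x =
  let m , c , maximal = largest (chain? R x) n (single x) (chain-length≤ R (single x))
  in m , c , λ j c′ → maximal j c′ (chain-length≤ R c′)

νRep-exists : ∀ {n} (R : Rep n) → ∃ (NuRep R)
νRep-exists {zero} R = 0 , inj₁ (refl , refl)
νRep-exists {suc n} R =
  let m , (x , c) , maximal =
        largest (λ j → any? λ x → chain? R x j) (suc n) (Fin.zero , single Fin.zero) (s≤s z≤n)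
      bounded : ∀ y {j} → Chain R y j → j ≤ m
      bounded y c′ = maximal _ (y , c′) (chain-length≤ R c′)
  in m , inj₂ ((x , c , λ _ → bounded x) , λ y _ (c′ , _) → bounded y c′)

chain≤ν : ∀ {n} {R : Rep n} {m x j} → NuRep R m → Chain R x j → j ≤ m
chain≤ν {x = ()} (inj₁ (refl , _)) _
chain≤ν {R = R} {x = x} (inj₂ (_ , maximal)) c =
  let k , νx = νVertex-exists R x in ≤-trans (proj₂ νx _ c) (maximal x k νx)

ν≤bound : ∀ {n} {R : Rep n} {m B} → NuRep R m → (∀ x j → Chain R x j → j ≤ B) → m ≤ B
ν≤bound (inj₁ (_ , refl)) _ = z≤n
ν≤bound (inj₂ ((x , c , _) , _)) bound = bound x _ c

νGraph≤ : ∀ {H b B} → NuGraph H b → {R : Rep (size H)} → IsIntervalRep H R →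
  (∀ x j → Chain R x j → j ≤ B) → b ≤ B
νGraph≤ (_ , minimal) {R} rep bound =
  let m , νR = νRep-exists R in ≤-trans (minimal R m rep νR) (ν≤bound νR bound)

-- ν is monotone along induced subgraphs

record InducedEmbedding (G H : Graph) : Set where
  field
    embed     : Fin (size G) → Fin (size H)
    injective : ∀ x y → embed x ≡ embed y → x ≡ y
    adjacency : ∀ x y → x ≢ y → Adj H (embed x) (embed y) ≡ Adj G x y
open InducedEmbedding

restrict : ∀ {G H} (e : InducedEmbedding G H) {R : Rep (size H)} →
  IsIntervalRep H R → IsIntervalRep G (R ∘ embed e)
restrict e {R} rep x y x≢y =
  subst (λ b → (b ≡ true) ⇔ Intersect (R (embed e x)) (R (embed e y)))
        (adjacency e x y x≢y)
        (rep (embed e x) (embed e y) (x≢y ∘ injective e x y))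

map-chain : ∀ {n n′} (f : Fin n → Fin n′) {R : Rep n′} {x j} → Chain (R ∘ f) x j → Chain R (f x) j
map-chain f (single x) = single (f x)
map-chain f (step c y⊊x) = step (map-chain f c) y⊊x

ν-monotone : ∀ {G H k b} → InducedEmbedding G H → NuGraph G k → NuGraph H b → k ≤ b
ν-monotone e νG ((R , rep , νR) , _) =
  νGraph≤ νG (restrict e {R} rep) λ _ _ c → chain≤ν νR (map-chain (embed e) c)

attachAdj : (m : ℕ) → (Fin m → Bool) → (G : Graph) → Fin m ⊎ Fin (size G) → Fin m ⊎ Fin (size G) → Bool
attachAdj m U G (inj₁ g) (inj₁ h) = pathAdj g h
attachAdj m U G (inj₁ g) (inj₂ _) = U g
attachAdj m U G (inj₂ _) (inj₁ h) = U h
attachAdj m U G (inj₂ x) (inj₂ y) = Adj G x y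

attach-Adj : ∀ m U G x y → Adj (attach m U G) x y ≡ attachAdj m U G (splitAt m x) (splitAt m y)
attach-Adj m U G x y with splitAt m x | splitAt m y
... | inj₁ _ | inj₁ _ = refl
... | inj₁ _ | inj₂ _ = refl
... | inj₂ _ | inj₁ _ = refl
... | inj₂ _ | inj₂ _ = refl

splitAt-injective : ∀ m {n} {x y : Fin (m + n)} → splitAt m x ≡ splitAt m y → x ≡ y
splitAt-injective m {n} {x} {y} same = begin
  x                      ≡⟨ join-splitAt m n x ⟨
  join m n (splitAt m x) ≡⟨ cong (join m n) same ⟩
  join m n (splitAt m y) ≡⟨ join-splitAt m n y ⟩
  y                      ∎
  where open ≡-Reasoning

base-embedding : ∀ m U G → InducedEmbedding G (attach m U G)
base-embedding m U G = record
  { embed     = m ↑ʳ_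
  ; injective = ↑ʳ-injective m
  ; adjacency = λ x y _ → begin
      Adj (attach m U G) (m ↑ʳ x) (m ↑ʳ y)
        ≡⟨ attach-Adj m U G _ _ ⟩
      attachAdj m U G (splitAt m (m ↑ʳ x)) (splitAt m (m ↑ʳ y))
        ≡⟨ cong₂ (attachAdj m U G) (splitAt-↑ʳ m _ x) (splitAt-↑ʳ m _ y) ⟩
      Adj G x y
        ∎
  }
  where open ≡-Reasoning

gadget-embedding : ∀ {m m′} {U : Fin m → Bool} {U′ : Fin m′ → Bool} (e : Fin m → Fin m′) →
  (∀ g h → e g ≡ e h → g ≡ h) → (∀ g h → pathAdj (e g) (e h) ≡ pathAdj g h) → (∀ g → U′ (e g) ≡ U g) →
  ∀ G → InducedEmbedding (attach m U G) (attach m′ U′ G)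
gadget-embedding {m} {m′} {U} {U′} e e-injective e-path e-hub G = record
  { embed = embed′ ; injective = injective′ ; adjacency = adjacency′ }
  where
  open ≡-Reasoning
  n = size G

  embed′ : Fin (m + n) → Fin (m′ + n)
  embed′ z = join m′ n (relabel e (splitAt m z))

  split-embed : ∀ z → splitAt m′ (embed′ z) ≡ relabel e (splitAt m z)
  split-embed z = splitAt-join m′ n _

  relabel-injective : ∀ s t → relabel e s ≡ relabel e t → s ≡ t
  relabel-injective (inj₁ g) (inj₁ h) same = cong inj₁ (e-injective g h (inj₁-injective same))
  relabel-injective (inj₂ x) (inj₂ y) refl = refl

  relabel-Adj : ∀ s t → attachAdj m′ U′ G (relabel e s) (relabel e t) ≡ attachAdj m U G s t
  relabel-Adj (inj₁ g) (inj₁ h) = e-path g h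
  relabel-Adj (inj₁ g) (inj₂ _) = e-hub g
  relabel-Adj (inj₂ _) (inj₁ h) = e-hub h
  relabel-Adj (inj₂ _) (inj₂ _) = refl

  injective′ : ∀ x y → embed′ x ≡ embed′ y → x ≡ y
  injective′ x y same = splitAt-injective m (relabel-injective _ _ (begin
    relabel e (splitAt m x)   ≡⟨ split-embed x ⟨
    splitAt m′ (embed′ x)     ≡⟨ cong (splitAt m′) same ⟩
    splitAt m′ (embed′ y)     ≡⟨ split-embed y ⟩
    relabel e (splitAt m y)   ∎))

  adjacency′ : ∀ x y → x ≢ y → Adj (attach m′ U′ G) (embed′ x) (embed′ y) ≡ Adj (attach m U G) x y
  adjacency′ x y _ = begin
    Adj (attach m′ U′ G) (embed′ x) (embed′ y)
      ≡⟨ attach-Adj m′ U′ G _ _ ⟩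
    attachAdj m′ U′ G (splitAt m′ (embed′ x)) (splitAt m′ (embed′ y))
      ≡⟨ cong₂ (attachAdj m′ U′ G) (split-embed x) (split-embed y) ⟩
    attachAdj m′ U′ G (relabel e (splitAt m x)) (relabel e (splitAt m y))
      ≡⟨ relabel-Adj (splitAt m x) (splitAt m y) ⟩
    attachAdj m U G (splitAt m x) (splitAt m y)
      ≡⟨ attach-Adj m U G x y ⟨
    Adj (attach m U G) x y
      ∎

-- G_β is an induced subgraph of G_γ: its gadget a₂ a₁ u_β is the start a₂ a₁ u_γ of G_γ's gadget.
β-into-γ : ∀ G → InducedEmbedding (Gβ G) (Gγ G)
β-into-γ = gadget-embedding (_↑ˡ 3) (↑ˡ-injective 3) path-kept hub-kept
  where
  path-kept : ∀ g h → pathAdj (g ↑ˡ 3) (h ↑ˡ 3) ≡ pathAdj g h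
  path-kept g h rewrite toℕ-↑ˡ g 3 | toℕ-↑ˡ h 3 = refl

  hub-kept : ∀ g → Uγ (g ↑ˡ 3) ≡ Uβ g
  hub-kept Fin.zero = refl
  hub-kept (Fin.suc Fin.zero) = refl
  hub-kept (Fin.suc (Fin.suc Fin.zero)) = refl

-- Lower bound: ν(G_α) ≥ ν(G) + 1

inside-hub-ordered : ∀ (a₂ a₁ u b₁ b₂ x : Interval) → hi a₁ Q.< lo b₁ →
  Intersect a₂ a₁ → ¬ Intersect a₂ u → Intersect a₁ u →
  Intersect b₂ b₁ → ¬ Intersect b₂ u → Intersect b₁ u →
  Intersect x u → ¬ Intersect x a₁ → ¬ Intersect x b₁ → x ⊊I u
inside-hub-ordered a₂ a₁ u b₁ b₂ x a₁<b₁ a₂∩a₁ a₂∦u a₁∩u b₂∩b₁ b₂∦u b₁∩u x∩u x∦a₁ x∦b₁ =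
  ⊊⇐ {x} {u} (QP.<⇒≤ u-starts-first) (QP.<⇒≤ x-ends-first) (inj₁ u-starts-first)
  where
  a₂a₁ = meet⇒ {a₂} {a₁} a₂∩a₁
  a₁u  = meet⇒ {a₁} {u} a₁∩u
  b₂b₁ = meet⇒ {b₂} {b₁} b₂∩b₁
  b₁u  = meet⇒ {b₁} {u} b₁∩u
  xu   = meet⇒ {x} {u} x∩u

  -- a₂ cannot lie right of u, since a₂ reaches a₁, which is left of b₁ and so of hi u.
  a₂-before-u : hi a₂ Q.< lo u
  a₂-before-u with disjoint⇒ {a₂} {u} a₂∦u
  ... | inj₁ a₂<u = a₂<u
  ... | inj₂ u<a₂ = ⊥-elim (<⇒≱ (QP.<-trans (QP.<-≤-trans u<a₂ (proj₁ a₂a₁)) a₁<b₁) (proj₁ b₁u))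

  -- x cannot lie left of a₁ (it would miss u), so it starts after a₁ ends, inside u.
  u-starts-first : lo u Q.< lo x
  u-starts-first with disjoint⇒ {x} {a₁} x∦a₁
  ... | inj₁ x<a₁ = ⊥-elim (<⇒≱ (QP.<-trans (QP.<-≤-trans x<a₁ (proj₂ a₂a₁)) a₂-before-u) (proj₂ xu))
  ... | inj₂ a₁<x = QP.≤-<-trans (proj₂ a₁u) a₁<x

  -- The mirror images of the two facts above, on the side of b₁ and b₂.
  u-before-b₂ : hi u Q.< lo b₂
  u-before-b₂ with disjoint⇒ {b₂} {u} b₂∦u
  ... | inj₁ b₂<u = ⊥-elim (<⇒≱ (QP.≤-<-trans (proj₂ b₂b₁) b₂<u) (QP.≤-trans (proj₂ a₁u) (QP.<⇒≤ a₁<b₁)))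
  ... | inj₂ u<b₂ = u<b₂

  x-ends-first : hi x Q.< hi u
  x-ends-first with disjoint⇒ {x} {b₁} x∦b₁
  ... | inj₁ x<b₁ = QP.<-≤-trans x<b₁ (proj₁ b₁u)
  ... | inj₂ b₁<x = ⊥-elim (<⇒≱ (QP.<-trans (QP.<-≤-trans u-before-b₂ (proj₁ b₂b₁)) b₁<x) (proj₁ xu))

inside-hub : ∀ (a₂ a₁ u b₁ b₂ x : Interval) → ¬ Intersect a₁ b₁ →
  Intersect a₂ a₁ → ¬ Intersect a₂ u → Intersect a₁ u →
  Intersect b₂ b₁ → ¬ Intersect b₂ u → Intersect b₁ u →
  Intersect x u → ¬ Intersect x a₁ → ¬ Intersect x b₁ → x ⊊I u
inside-hub a₂ a₁ u b₁ b₂ x a₁∦b₁ a₂∩a₁ a₂∦u a₁∩u b₂∩b₁ b₂∦u b₁∩u x∩u x∦a₁ x∦b₁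
  with disjoint⇒ {a₁} {b₁} a₁∦b₁
... | inj₁ a₁<b₁ = inside-hub-ordered a₂ a₁ u b₁ b₂ x a₁<b₁
                     a₂∩a₁ a₂∦u a₁∩u b₂∩b₁ b₂∦u b₁∩u x∩u x∦a₁ x∦b₁
... | inj₂ b₁<a₁ = inside-hub-ordered b₂ b₁ u a₁ a₂ x b₁<a₁
                     b₂∩b₁ b₂∦u b₁∩u a₂∩a₁ a₂∦u a₁∩u x∩u x∦b₁ x∦a₁

adjacent⇒meet : ∀ {H R} → IsIntervalRep H R → ∀ x y → x ≢ y → Adj H x y ≡ true → Intersect (R x) (R y)
adjacent⇒meet rep x y x≢y = to (rep x y x≢y)

nonadjacent⇒disjoint : ∀ {H R} → IsIntervalRep H R → ∀ x y → x ≢ y → Adj H x y ≡ false → ¬ Intersect (R x) (R y)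
nonadjacent⇒disjoint rep x y x≢y nonadj meet with trans (sym nonadj) (from (rep x y x≢y) meet)
... | ()

a₂ a₁ uα b₁ b₂ : ∀ {n} → Fin (5 + n)
a₂ = Fin.zero
a₁ = Fin.suc Fin.zero
uα = Fin.suc (Fin.suc Fin.zero)
b₁ = Fin.suc (Fin.suc (Fin.suc Fin.zero))
b₂ = Fin.suc (Fin.suc (Fin.suc (Fin.suc Fin.zero)))

hub-contains-base : ∀ G {R} → IsIntervalRep (Gα G) R → ∀ x → R (5 ↑ʳ x) ⊊I R uα
hub-contains-base G {R} rep x = inside-hub (R a₂) (R a₁) (R uα) (R b₁) (R b₂) (R (5 ↑ʳ x))
  (apart a₁ b₁ (λ ()) refl)
  (meet a₂ a₁ (λ ()) refl) (apart a₂ uα (λ ()) refl) (meet a₁ uα (λ ()) refl)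
  (meet b₂ b₁ (λ ()) refl) (apart b₂ uα (λ ()) refl) (meet b₁ uα (λ ()) refl)
  (meet (5 ↑ʳ x) uα (λ ()) refl) (apart (5 ↑ʳ x) a₁ (λ ()) refl) (apart (5 ↑ʳ x) b₁ (λ ()) refl)
  where
  meet  = adjacent⇒meet {Gα G} {R} rep
  apart = nonadjacent⇒disjoint {Gα G} {R} rep

-- Every chain of G extends by u_α on top, and u_α alone is a chain even if G is empty.
lower-α : ∀ G {k a} → NuGraph G k → NuGraph (Gα G) a → suc k ≤ a
lower-α G {a = zero} _ ((R , _ , νR) , _) with chain≤ν νR (single {R = R} uα)
... | ()
lower-α G {a = suc a} νG ((R , rep , νR) , _) =
  s≤s (νGraph≤ νG (restrict (base-embedding 5 Uα G) {R} rep) λ x j c → ≤-pred (extend x j c))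
  where
  extend : ∀ x j → Chain (R ∘ (5 ↑ʳ_)) x j → suc j ≤ suc a
  extend x _ c = chain≤ν νR (step (map-chain (5 ↑ʳ_) c) (hub-contains-base G {R} rep x))

-- Upper bound: attaching a gadget raises ν by at most one

span : ∀ {n} (R : Rep n) → ∃₂ λ L H → L Q.≤ H × (∀ x → (L Q.≤ lo (R x)) × (hi (R x) Q.≤ H))
span {zero} R = 0ℚ , 0ℚ , QP.≤-refl , λ ()
span {suc n} R =
  let L , H , L≤H , within = span (R ∘ Fin.suc)
      I = R Fin.zero
  in lo I Q.⊓ L , hi I Q.⊔ H
     , QP.≤-trans (QP.p⊓q≤p (lo I) L) (QP.≤-trans (lo≤hi I) (QP.p≤p⊔q (hi I) H))
     , λ { Fin.zero → QP.p⊓q≤p (lo I) L , QP.p≤p⊔q (hi I) H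
         ; (Fin.suc x) → QP.≤-trans (QP.p⊓q≤q (lo I) L) (proj₁ (within x))
                        , QP.≤-trans (proj₂ (within x)) (QP.p≤q⊔p (hi I) H) }

-- Gadget endpoints are placed symbolically, as rational offsets from the ends L, H of
-- that segment; a point gets its value once L and H are fixed.
data Anchor : Set where
  atL atH : Anchor

Point : Set
Point = Anchor × ℚ

value : ℚ → ℚ → Point → ℚ
value L _ (atL , c) = L Q.+ c
value _ H (atH , c) = H Q.+ c

-- Order tests on points that are sound for every L ≤ H.
_≤ᵖ_ _<ᵖ_ : Point → Point → Bool
(atH , _) ≤ᵖ (atL , _) = false
(_ , c) ≤ᵖ (_ , d) = isYes (c Q.≤? d)
(atH , _) <ᵖ (atL , _) = false
(_ , c) <ᵖ (_ , d) = isYes (c Q.<? d)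

≤ᵖ-sound : ∀ {L H} → L Q.≤ H → ∀ p q → T (p ≤ᵖ q) → value L H p Q.≤ value L H q
≤ᵖ-sound {L}     _   (atL , c) (atL , d) c≤d = QP.+-monoʳ-≤ L (toWitness {a? = c Q.≤? d} c≤d)
≤ᵖ-sound         L≤H (atL , c) (atH , d) c≤d = QP.+-mono-≤ L≤H (toWitness {a? = c Q.≤? d} c≤d)
≤ᵖ-sound {H = H} _   (atH , c) (atH , d) c≤d = QP.+-monoʳ-≤ H (toWitness {a? = c Q.≤? d} c≤d)

<ᵖ-sound : ∀ {L H} → L Q.≤ H → ∀ p q → T (p <ᵖ q) → value L H p Q.< value L H q
<ᵖ-sound {L}     _   (atL , c) (atL , d) c<d = QP.+-monoʳ-< L (toWitness {a? = c Q.<? d} c<d)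
<ᵖ-sound         L≤H (atL , c) (atH , d) c<d = QP.+-mono-≤-< L≤H (toWitness {a? = c Q.<? d} c<d)
<ᵖ-sound {H = H} _   (atH , c) (atH , d) c<d = QP.+-monoʳ-< H (toWitness {a? = c Q.<? d} c<d)

L₀ H₀ : Point
L₀ = atL , 0ℚ
H₀ = atH , 0ℚ

record Layout (m : ℕ) (U : Fin m → Bool) : Set where
  field
    start end : Fin m → Point
    proper    : ∀ g → T (start g ≤ᵖ end g)
    path      : ∀ g h → g ≢ h → T (if pathAdj g h then (start g ≤ᵖ end h) ∧ (start h ≤ᵖ end g)
                                                  else (end g <ᵖ start h) ∨ (end h <ᵖ start g))
    hubs      : ∀ g → T (if U g then (start g <ᵖ L₀) ∧ (H₀ <ᵖ end g)
                                else (end g <ᵖ L₀) ∨ (H₀ <ᵖ start g))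
    unnested  : ∀ g h → g ≢ h → T ((start g <ᵖ start h) ∨ (end h <ᵖ end g))

if-true : ∀ {b x y} → b ≡ true → T (if b then x else y) → T x
if-true refl t = t

if-false : ∀ {b x y} → b ≡ false → T (if b then x else y) → T y
if-false refl t = t

decides : ∀ {P : Set} (b : Bool) → (b ≡ true → P) → (b ≡ false → ¬ P) → (b ≡ true) ⇔ P
decides true  yes-P _    = mk⇔ yes-P (λ _ → refl)
decides false _     no-P = mk⇔ (λ ()) (λ p → ⊥-elim (no-P refl p))

module Placement {m} {U : Fin m → Bool} (layout : Layout m U) {G : Graph} {R₀ : Rep (size G)}
                 (rep₀ : IsIntervalRep G R₀) {L H : ℚ} (L≤H : L Q.≤ H)
                 (within : ∀ x → (L Q.≤ lo (R₀ x)) × (hi (R₀ x) Q.≤ H)) where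
  open Layout layout
  n = size G

  ⟦_⟧ : Point → ℚ
  ⟦_⟧ = value L H

  gadget : Fin m → Interval
  gadget g = ⟦ ⟦ start g ⟧ , ⟦ end g ⟧ ⟧⟨ ≤ᵖ-sound L≤H (start g) (end g) (proper g) ⟩

  view : Fin m ⊎ Fin n → Interval
  view = [ gadget , R₀ ]

  R : Rep (m + n)
  R z = view (splitAt m z)

  ⟦L₀⟧≤ : ∀ x → ⟦ L₀ ⟧ Q.≤ lo (R₀ x)
  ⟦L₀⟧≤ x = QP.≤-trans (QP.≤-reflexive (QP.+-identityʳ L)) (proj₁ (within x))

  ≤⟦H₀⟧ : ∀ x → hi (R₀ x) Q.≤ ⟦ H₀ ⟧
  ≤⟦H₀⟧ x = QP.≤-trans (proj₂ (within x)) (QP.≤-reflexive (sym (QP.+-identityʳ H)))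

  <-sound : ∀ p q → T (p <ᵖ q) → ⟦ p ⟧ Q.< ⟦ q ⟧
  <-sound = <ᵖ-sound L≤H

  covers : ∀ g → U g ≡ true → ∀ x → (lo (gadget g) Q.< lo (R₀ x)) × (hi (R₀ x) Q.< hi (gadget g))
  covers g hub x =
    let before , after = to T-∧ (if-true hub (hubs g))
    in QP.<-≤-trans (<-sound (start g) L₀ before) (⟦L₀⟧≤ x)
     , QP.≤-<-trans (≤⟦H₀⟧ x) (<-sound H₀ (end g) after)

  avoids : ∀ g → U g ≡ false → ∀ x → (hi (gadget g) Q.< lo (R₀ x)) ⊎ (hi (R₀ x) Q.< lo (gadget g))
  avoids g not-hub x with to T-∨ (if-false not-hub (hubs g))
  ... | inj₁ before = inj₁ (QP.<-≤-trans (<-sound (end g) L₀ before) (⟦L₀⟧≤ x))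
  ... | inj₂ after  = inj₂ (QP.≤-<-trans (≤⟦H₀⟧ x) (<-sound H₀ (start g) after))

  gadget-meets-base : ∀ g x → (U g ≡ true) ⇔ Intersect (gadget g) (R₀ x)
  gadget-meets-base g x = decides (U g)
    (λ hub → let before , after = covers g hub x
             in meet⇐ {gadget g} {R₀ x} (QP.≤-trans (QP.<⇒≤ before) (lo≤hi (R₀ x)))
                                        (QP.≤-trans (lo≤hi (R₀ x)) (QP.<⇒≤ after)))
    (λ not-hub → [ before⇒disjoint {gadget g} {R₀ x} , after⇒disjoint {gadget g} {R₀ x} ]
                   (avoids g not-hub x))

  gadget-meets-gadget : ∀ g h → g ≢ h → (pathAdj g h ≡ true) ⇔ Intersect (gadget g) (gadget h)
  gadget-meets-gadget g h g≢h = decides (pathAdj g h)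
    (λ adj → let gh , hg = to T-∧ (if-true adj (path g h g≢h))
             in meet⇐ {gadget g} {gadget h} (≤ᵖ-sound L≤H (start g) (end h) gh)
                                            (≤ᵖ-sound L≤H (start h) (end g) hg))
    (λ nonadj → [ before⇒disjoint {gadget g} {gadget h} ∘ <-sound (end g) (start h)
                , after⇒disjoint {gadget g} {gadget h} ∘ <-sound (end h) (start g) ]
                (to T-∨ (if-false nonadj (path g h g≢h))))

  represents-view : ∀ s t → s ≢ t → (attachAdj m U G s t ≡ true) ⇔ Intersect (view s) (view t)
  represents-view (inj₁ g) (inj₁ h) s≢t = gadget-meets-gadget g h (s≢t ∘ cong inj₁)
  represents-view (inj₁ g) (inj₂ x) _ = gadget-meets-base g x
  represents-view (inj₂ x) (inj₁ g) _ =
    mk⇔ (meet-sym {gadget g} {R₀ x} ∘ to (gadget-meets-base g x))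
        (from (gadget-meets-base g x) ∘ meet-sym {R₀ x} {gadget g})
  represents-view (inj₂ x) (inj₂ y) s≢t = rep₀ x y (s≢t ∘ cong inj₂)

  represents : IsIntervalRep (attach m U G) R
  represents x y x≢y =
    subst (λ b → (b ≡ true) ⇔ Intersect (R x) (R y)) (sym (attach-Adj m U G x y))
          (represents-view (splitAt m x) (splitAt m y) (x≢y ∘ splitAt-injective m))

  gadget-not-in-base : ∀ g x → ¬ (gadget g ⊆I R₀ x)
  gadget-not-in-base g x with U g in hub?
  ... | true = ¬⊆-lo {gadget g} {R₀ x} (proj₁ (covers g hub? x))
  ... | false with avoids g hub? x
  ...   | inj₁ before = ¬⊆-lo {gadget g} {R₀ x} (QP.≤-<-trans (lo≤hi (gadget g)) before)
  ...   | inj₂ after  = ¬⊆-hi {gadget g} {R₀ x} (QP.<-≤-trans after (lo≤hi (gadget g)))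

  gadget-not-in-gadget : ∀ h g → ¬ (gadget h ⊊I gadget g)
  gadget-not-in-gadget h g with h ≟ g
  ... | yes refl = ⊊-irrefl {gadget g}
  ... | no h≢g with to T-∨ (unnested h g h≢g)
  ...   | inj₁ starts-before = ¬⊆-lo {gadget h} {gadget g} (<-sound (start h) (start g) starts-before) ∘ proj₁
  ...   | inj₂ ends-after    = ¬⊆-hi {gadget h} {gadget g} (<-sound (end g) (end h) ends-after) ∘ proj₁

  no-gadget-below : ∀ h t → ¬ (gadget h ⊊I view t)
  no-gadget-below h (inj₁ g) = gadget-not-in-gadget h g
  no-gadget-below h (inj₂ x) = gadget-not-in-base h x ∘ proj₁

  below-is-base : ∀ {y z} → R y ⊊I R z → ∃ λ x → splitAt m y ≡ inj₂ x
  below-is-base {y} {z} y⊊z = classify (splitAt m y) refl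
    where
    classify : ∀ s → splitAt m y ≡ s → ∃ λ x → splitAt m y ≡ inj₂ x
    classify (inj₁ h) y≡h =
      ⊥-elim (no-gadget-below h (splitAt m z) (subst (λ s → view s ⊊I R z) y≡h y⊊z))
    classify (inj₂ x) y≡x = x , y≡x

  base-chain : ∀ {z x j} → splitAt m z ≡ inj₂ x → Chain R z j → Chain R₀ x j
  base-chain _ (single _) = single _
  base-chain z≡x (step c y⊊z) =
    let _ , y≡x′ = below-is-base y⊊z
    in step (base-chain y≡x′ c) (subst₂ (λ s t → view s ⊊I view t) y≡x′ z≡x y⊊z)

  -- ... and one ending at a gadget vertex is a chain of R₀ plus that vertex.
  chain-bound : ∀ {B} → (∀ x j → Chain R₀ x j → j ≤ B) → ∀ z j → Chain R z j → j ≤ suc B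
  chain-bound {B} bound z _ = by-view (splitAt m z) refl
    where
    by-view : ∀ {j} s → splitAt m z ≡ s → Chain R z j → j ≤ suc B
    by-view (inj₂ x) z≡x c = m≤n⇒m≤1+n (bound x _ (base-chain z≡x c))
    by-view (inj₁ _) _ (single _) = s≤s z≤n
    by-view (inj₁ _) _ (step c y⊊z) =
      let x , y≡x = below-is-base y⊊z in s≤s (bound x _ (base-chain y≡x c))

-- Any gadget admitting a layout raises ν by at most one: place it around an optimal
-- representation of G.
upper : ∀ {m U} → Layout m U → ∀ G {k a} → NuGraph G k → NuGraph (attach m U G) a → a ≤ suc k
upper layout G ((R₀ , rep₀ , νR₀) , _) νA =
  let _ , _ , L≤H , within = span R₀
      open Placement layout rep₀ L≤H within
  in νGraph≤ νA represents (chain-bound λ _ _ → chain≤ν νR₀)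

-- Layouts for G_α and G_γ, verified by evaluation

by-evaluation : ∀ {m} (c : Fin m → Bool) → {True (all? λ g → T? (c g))} → ∀ g → T (c g)
by-evaluation c {ok} = toWitness ok

by-evaluation₂ : ∀ {m} (c : Fin m → Fin m → Bool) →
  {True (all? λ g → all? λ h → ¬? (g ≟ h) →-dec T? (c g h))} → ∀ g h → g ≢ h → T (c g h)
by-evaluation₂ c {ok} = toWitness ok

L- H+ : ℕ → Point
L- d = atL , Q.- ((+ d) Q./ 1)
H+ d = atH , (+ d) Q./ 1

-- a₂ = [L-5, L-3], a₁ = [L-3, L-1], u_α = [L-1, H+1], b₁ = [H+1, H+3], b₂ = [H+3, H+5]
layout-α : Layout 5 Uα
layout-α = record
  { start    = lookup (L- 5 ∷ L- 3 ∷ L- 1 ∷ H+ 1 ∷ H+ 3 ∷ [])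
  ; end      = lookup (L- 3 ∷ L- 1 ∷ H+ 1 ∷ H+ 3 ∷ H+ 5 ∷ [])
  ; proper   = by-evaluation _
  ; path     = by-evaluation₂ _
  ; hubs     = by-evaluation _
  ; unnested = by-evaluation₂ _
  }

-- a₂ = [L-6, L-4], a₁ = [L-4, L-2], u_γ = [L-2, H+1], v_γ = [L-1, H+2], b₁ = [H+2, H+4], b₂ = [H+4, H+6]
layout-γ : Layout 6 Uγ
layout-γ = record
  { start    = lookup (L- 6 ∷ L- 4 ∷ L- 2 ∷ L- 1 ∷ H+ 2 ∷ H+ 4 ∷ [])
  ; end      = lookup (L- 4 ∷ L- 2 ∷ H+ 1 ∷ H+ 2 ∷ H+ 4 ∷ H+ 6 ∷ [])
  ; proper   = by-evaluation _
  ; path     = by-evaluation₂ _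
  ; hubs     = by-evaluation _
  ; unnested = by-evaluation₂ _
  }

triples : ∀ {k a b c} → a ≡ suc k → k ≤ b → b ≤ c → c ≤ suc k →
    ((a ≡ suc k) × (b ≡ k) × (c ≡ k))
    ⊎ ((a ≡ suc k) × (b ≡ k) × (c ≡ suc k))
    ⊎ ((a ≡ suc k) × (b ≡ suc k) × (c ≡ suc k))
triples a≡k+1 k≤b b≤c c≤k+1 with m≤n⇒m<n∨m≡n c≤k+1 | m≤n⇒m<n∨m≡n (≤-trans b≤c c≤k+1)
... | inj₁ c<k+1 | _           =
  inj₁ (a≡k+1 , ≤-antisym (≤-trans b≤c (≤-pred c<k+1)) k≤b , ≤-antisym (≤-pred c<k+1) (≤-trans k≤b b≤c))
... | inj₂ refl  | inj₁ b<k+1  = inj₂ (inj₁ (a≡k+1 , ≤-antisym (≤-pred b<k+1) k≤b , refl))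
... | inj₂ refl  | inj₂ refl   = inj₂ (inj₂ (a≡k+1 , refl , refl))

mainTheorem3 : (G : Graph) → IsIntervalGraph G →
    (k a b c : ℕ) → NuGraph G k →
    NuGraph (Gα G) a → NuGraph (Gβ G) b → NuGraph (Gγ G) c →
      ((a ≡ suc k) × (b ≡ k) × (c ≡ k))
      ⊎ ((a ≡ suc k) × (b ≡ k) × (c ≡ suc k))
      ⊎ ((a ≡ suc k) × (b ≡ suc k) × (c ≡ suc k))
mainTheorem3 G _ k a b c νG νGα νGβ νGγ =
  triples (≤-antisym (upper layout-α G νG νGα) (lower-α G νG νGα))
          (ν-monotone (base-embedding 3 Uβ G) νG νGβ)
          (ν-monotone (β-into-γ G) νGβ νGγ)
          (upper layout-γ G νG νGγ)
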